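{- Let $x,y$ be two adjacent vertices in a finite bipartite graph $G$ with $N^2(x)\subseteq N(y)$. Then $y$ is rare, i.e. $y$ belongs to at most half of the maximal stable sets of $G$.
   Context: $N(v)$ is the set of neighbours of a vertex $v$, $N(S)$ the set of vertices adjacent to some vertex of $S$, and $N^2(x)=N(N(x))$. A set of vertices is stable if no two are adjacent; maximal means maximal under inclusion. A vertex $v$ is rare if $|\mathcal A_v|\le\frac12|\mathcal A|$, where $\mathcal A$ is the set of all maximal stable sets of $G$ and $\mathcal A_v$ those containing $v$. -}

module Defs where

open import Data.Nat using (ℕ)
open import Data.Fin using (Fin)
open import Data.Fin.Subset using (Subset; _∈_; _⊆_)
open import Data.Bool using (Bool)
open import Data.Product using (Σ; _×_; ∃-syntax)
open import Data.Empty using (⊥)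
open import Relation.Nullary using (¬_)
open import Relation.Binary.PropositionalEquality using (_≡_; _≢_)
open import Data.List using (List)
import Data.List.Membership.Propositional as LM
open import Data.List.Relation.Unary.Unique.Propositional using (Unique)
open import Function.Bundles using (_⇔_)

record Graph (n : ℕ) : Set₁ where
  field
    E     : Fin n → Fin n → Set
    sym   : ∀ {u v} → E u v → E v u
    irref : ∀ {u} → ¬ E u u

module _ {n : ℕ} (G : Graph n) where
  open Graph G

  Bipartite : Set
  Bipartite = Σ (Fin n → Bool) λ c → ∀ u v → E u v → c u ≢ c v

  InN : Fin n → Fin n → Set
  InN v z = E v z

  InN² : Fin n → Fin n → Set
  InN² v z = ∃[ w ] (E v w × E w z)

  Stable : Subset n → Set
  Stable S = ∀ u v → u ∈ S → v ∈ S → ¬ E u v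

  MaximalStable : Subset n → Set
  MaximalStable S = Stable S × (∀ T → Stable T → S ⊆ T → T ⊆ S)

  -- v is rare: |A_v| ≤ |A|/2, phrased via duplicate-free enumerations
  -- LA of A (all maximal stable sets) and LAv of A_v (those containing v):
  -- 2·|A_v| ≤ |A|.
  Rare : Fin n → Set
  Rare v = (LA LAv : List (Subset n))
         → Unique LA → (∀ S → (S LM.∈ LA) ⇔ MaximalStable S)
         → Unique LAv → (∀ S → (S LM.∈ LAv) ⇔ (MaximalStable S × v ∈ S))
         → 2 Data.Nat.* Data.List.length LAv Data.Nat.≤ Data.List.length LA

module Submission where

-- Let A_y be the maximal stable sets containing y. Every S ∈ A_y contains
-- N(x) and avoids N²(x) (its members are neighbours of y). Exchange the
-- part N(x) of S for the vertices of N²(x) that have no neighbour left in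
-- S ∖ N(x). Since N²(x) lies in the colour class of x, the result is again
-- maximal stable; it contains x, hence not y; and S is recovered from it as
-- N(x) ∪ (exchange S ∖ N²(x)). So the exchange injects A_y into A ∖ A_y.

open import Defs
open import Data.Nat using (ℕ; zero; suc; _*_; _+_; _≤_; z≤n; s≤s; _≤?_)
open import Data.Nat.Properties using (+-identityʳ; module ≤-Reasoning)
open import Data.Fin using (Fin; zero; suc)
open import Data.Fin.Properties using (any?)
open import Data.Fin.Subset using (Subset; _∈_; _∉_; _⊆_; _∪_; ⁅_⁆)
open import Data.Fin.Subset.Properties
  using (_∈?_; x∈p∪q⁻; x∈p∪q⁺; x∈⁅x⁆; x∈⁅y⁆⇒x≡y; ⊆-antisym)
open import Data.Bool.Properties using (¬-not; T-≡)
open import Data.Vec using (tabulate)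
open import Data.Vec.Properties using ([]=⇒lookup; lookup⇒[]=; lookup∘tabulate)
open import Data.List using (List; length; map; _++_)
open import Data.List.Properties using (length-++; length-map; length-removeAt′)
open import Data.List.Membership.Propositional using (_─_)
  renaming (_∈_ to _∈ₗ_; _∉_ to _∉ₗ_)
open import Data.List.Membership.Propositional.Properties using (∈-map⁻; ∈-++⁻)
open import Data.List.Relation.Unary.Any using (here; there; index)
import Data.List.Relation.Unary.All as All
open import Data.List.Relation.Unary.All.Properties using () renaming (map⁺ to All-map⁺)
open import Data.List.Relation.Unary.AllPairs using ([]; _∷_)
open import Data.List.Relation.Unary.Unique.Propositional using (Unique)
open import Data.List.Relation.Unary.Unique.Propositional.Properties using (++⁺)
open import Data.List.Relation.Binary.Subset.Propositional using () renaming (_⊆_ to _⊆ₗ_)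
open import Data.Product using (_×_; _,_; proj₁; proj₂; ∃-syntax)
open import Data.Sum using (_⊎_; inj₁; inj₂)
open import Data.Empty using (⊥-elim)
open import Function.Bundles using (Equivalence)
open import Relation.Binary.Definitions using (Decidable)
open import Relation.Binary.PropositionalEquality
  using (_≡_; _≢_; refl; sym; trans; cong; subst; ≢-sym)
open import Relation.Nullary using (¬_; Dec; yes; no)
open import Relation.Nullary.Decidable
  using (_×-dec_; _⊎-dec_; ¬?; isYes; toWitness; fromWitness; decidable-stable; ¬¬-excluded-middle)
open import Relation.Nullary.Negation using (¬¬-map)

module _ {a} {A : Set a} where

  ∈-─ : ∀ {u v} {ys : List A} (v∈ys : v ∈ₗ ys) → u ∈ₗ ys → u ≢ v → u ∈ₗ ys ─ v∈ys
  ∈-─ (here refl) (here refl) u≢v = ⊥-elim (u≢v refl)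
  ∈-─ (here refl) (there u∈ys) _ = u∈ys
  ∈-─ (there _) (here refl) _ = here refl
  ∈-─ (there v∈ys) (there u∈ys) u≢v = there (∈-─ v∈ys u∈ys u≢v)

  Unique-⊆⇒length≤ : ∀ {xs ys : List A} → Unique xs → xs ⊆ₗ ys → length xs ≤ length ys
  Unique-⊆⇒length≤ [] _ = z≤n
  Unique-⊆⇒length≤ {ys = ys} (x∉xs ∷ xs!) xs⊆ys =
    subst (_ ≤_) (sym (length-removeAt′ ys (index x∈ys)))
      (s≤s (Unique-⊆⇒length≤ xs! λ u∈xs →
              ∈-─ x∈ys (xs⊆ys (there u∈xs)) (≢-sym (All.lookup x∉xs u∈xs))))
    where x∈ys = xs⊆ys (here refl)

  map⁺-injectiveOn : ∀ (f : A → A) {xs : List A}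
    → (∀ {u v} → u ∈ₗ xs → v ∈ₗ xs → f u ≡ f v → u ≡ v)
    → Unique xs → Unique (map f xs)
  map⁺-injectiveOn f inj [] = []
  map⁺-injectiveOn f inj (x∉xs ∷ xs!) =
    All-map⁺ (All.tabulate λ u∈xs fx≡fu →
                All.lookup x∉xs u∈xs (inj (here refl) (there u∈xs) fx≡fu))
      ∷ map⁺-injectiveOn f (λ u∈ v∈ → inj (there u∈) (there v∈)) xs!

  double-length≤ : ∀ (f : A → A) {xs ys : List A} → Unique xs
    → (∀ {u v} → u ∈ₗ xs → v ∈ₗ xs → f u ≡ f v → u ≡ v)
    → (∀ {u} → u ∈ₗ xs → f u ∉ₗ xs)
    → xs ⊆ₗ ys → (∀ {u} → u ∈ₗ xs → f u ∈ₗ ys)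
    → 2 * length xs ≤ length ys
  double-length≤ f {xs} {ys} xs! inj f∉xs xs⊆ys f∈ys = begin
    2 * length xs                ≡⟨ cong (length xs +_) (+-identityʳ (length xs)) ⟩
    length xs + length xs        ≡⟨ cong (length xs +_) (sym (length-map f xs)) ⟩
    length xs + length (map f xs) ≡⟨ sym (length-++ xs) ⟩
    length (xs ++ map f xs)      ≤⟨ Unique-⊆⇒length≤ both! both⊆ys ⟩
    length ys                    ∎
    where
    open ≤-Reasoning
    both! : Unique (xs ++ map f xs)
    both! = ++⁺ xs! (map⁺-injectiveOn f inj xs!) λ where
      (v∈xs , v∈fxs) → let (u , u∈xs , v≡fu) = ∈-map⁻ f v∈fxs
                       in f∉xs u∈xs (subst (_∈ₗ xs) v≡fu v∈xs)
    both⊆ys : (xs ++ map f xs) ⊆ₗ ys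
    both⊆ys v∈ with ∈-++⁻ xs v∈
    ... | inj₁ v∈xs = xs⊆ys v∈xs
    ... | inj₂ v∈fxs with u , u∈xs , refl ← ∈-map⁻ f v∈fxs = f∈ys u∈xs

¬¬-Π-Fin : ∀ {p} n {P : Fin n → Set p} → (∀ i → ¬ ¬ P i) → ¬ ¬ (∀ i → P i)
¬¬-Π-Fin zero ¬¬P ¬∀P = ¬∀P λ ()
¬¬-Π-Fin (suc n) ¬¬P ¬∀P =
  ¬¬P zero λ P0 → ¬¬-Π-Fin n (λ i → ¬¬P (suc i)) λ Psuc →
    ¬∀P λ { zero → P0 ; (suc i) → Psuc i }

module _ {n} {P : Fin n → Set} (P? : ∀ z → Dec (P z)) where

  fromDec : Subset n
  fromDec = tabulate (λ z → isYes (P? z))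

  ∈-fromDec⁺ : ∀ {z} → P z → z ∈ fromDec
  ∈-fromDec⁺ {z} p =
    lookup⇒[]= z fromDec (trans (lookup∘tabulate _ z) (Equivalence.to T-≡ (fromWitness {a? = P? z} p)))

  ∈-fromDec⁻ : ∀ {z} → z ∈ fromDec → P z
  ∈-fromDec⁻ {z} z∈ =
    toWitness {a? = P? z} (Equivalence.from T-≡ (trans (sym (lookup∘tabulate _ z)) ([]=⇒lookup z∈)))

module _ {n} (G : Graph n) where
  open Graph G renaming (sym to E-sym)

  N²-sameColour : (bip : Bipartite G) → ∀ {x z} → InN² G x z → proj₁ bip x ≡ proj₁ bip z
  N²-sameColour (c , proper) {x} {z} (w , xw , wz) =
    trans (¬-not (proper x w xw)) (sym (¬-not (proper z w (E-sym wz))))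

  Dominating : Subset n → Set
  Dominating S = ∀ v → v ∉ S → ∃[ w ] (w ∈ S × E v w)

  stable∧dominating⇒maximal : ∀ {S} → Stable G S → Dominating S → MaximalStable G S
  stable∧dominating⇒maximal {S} S-stable S-dom = S-stable , maximal
    where
    maximal : ∀ T → Stable G T → S ⊆ T → T ⊆ S
    maximal T T-stable S⊆T {v} v∈T with v ∈? S
    ... | yes v∈S = v∈S
    ... | no v∉S with w , w∈S , vw ← S-dom v v∉S = ⊥-elim (T-stable v w v∈T (S⊆T w∈S) vw)

  ∈-∪-⁅⁆⁻ : ∀ {S : Subset n} {u v} → u ∈ S ∪ ⁅ v ⁆ → u ∈ S ⊎ u ≡ v
  ∈-∪-⁅⁆⁻ {S} {u} {v} u∈ with x∈p∪q⁻ S ⁅ v ⁆ u∈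
  ... | inj₁ u∈S = inj₁ u∈S
  ... | inj₂ u∈⁅v⁆ = inj₂ (x∈⁅y⁆⇒x≡y v u∈⁅v⁆)

  stable-∪-⁅⁆ : ∀ {S v} → Stable G S → (∀ w → w ∈ S → ¬ E v w) → Stable G (S ∪ ⁅ v ⁆)
  stable-∪-⁅⁆ S-stable v-indep a b a∈ b∈ with ∈-∪-⁅⁆⁻ a∈ | ∈-∪-⁅⁆⁻ b∈
  ... | inj₁ a∈S | inj₁ b∈S = S-stable a b a∈S b∈S
  ... | inj₁ a∈S | inj₂ refl = λ ab → v-indep a a∈S (E-sym ab)
  ... | inj₂ refl | inj₁ b∈S = v-indep b b∈S
  ... | inj₂ refl | inj₂ refl = irref

  maximal⇒dominating : Decidable E → ∀ {S} → MaximalStable G S → Dominating S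
  maximal⇒dominating E? {S} (S-stable , S-maximal) v v∉S
    with any? (λ w → w ∈? S ×-dec E? v w)
  ... | yes neighbour = neighbour
  ... | no ¬neighbour = ⊥-elim (v∉S (S-maximal (S ∪ ⁅ v ⁆) ∪-stable
                                       (λ w∈S → x∈p∪q⁺ (inj₁ w∈S))
                                       (x∈p∪q⁺ (inj₂ (x∈⁅x⁆ v)))))
    where
    ∪-stable : Stable G (S ∪ ⁅ v ⁆)
    ∪-stable = stable-∪-⁅⁆ S-stable λ w w∈S vw → ¬neighbour (w , w∈S , vw)

module Exchange {n} (G : Graph n) (E? : Decidable (Graph.E G)) (bip : Bipartite G)
  {x y : Fin n} (xy : Graph.E G x y) (N²x⊆Ny : ∀ z → InN² G x z → InN G y z) where
  open Graph G renaming (sym to E-sym)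

  Kept : Subset n → Fin n → Set
  Kept S z = z ∈ S × ¬ E x z

  Freed : Subset n → Fin n → Set
  Freed S z = InN² G x z × ¬ (∃[ w ] (Kept S w × E z w))

  kept? : ∀ S z → Dec (Kept S z)
  kept? S z = z ∈? S ×-dec ¬? (E? x z)

  freed? : ∀ S z → Dec (Freed S z)
  freed? S z = any? (λ w → E? x w ×-dec E? w z) ×-dec ¬? (any? λ w → kept? S w ×-dec E? z w)

  exchange : Subset n → Subset n
  exchange S = fromDec (λ z → kept? S z ⊎-dec freed? S z)

  ∈-exchange⁺ : ∀ {S z} → Kept S z ⊎ Freed S z → z ∈ exchange S
  ∈-exchange⁺ {S} = ∈-fromDec⁺ (λ z → kept? S z ⊎-dec freed? S z)

  ∈-exchange⁻ : ∀ {S z} → z ∈ exchange S → Kept S z ⊎ Freed S z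
  ∈-exchange⁻ {S} = ∈-fromDec⁻ (λ z → kept? S z ⊎-dec freed? S z)

  x∈exchange : ∀ S → x ∈ exchange S
  x∈exchange S = ∈-exchange⁺ (inj₂ ((y , xy , E-sym xy) , λ { (w , (_ , ¬xw) , xw) → ¬xw xw }))

  y∉exchange : ∀ S → y ∉ exchange S
  y∉exchange S y∈ with ∈-exchange⁻ y∈
  ... | inj₁ (_ , ¬xy) = ¬xy xy
  ... | inj₂ (x~²y , _) = proj₂ bip x y xy (N²-sameColour G bip x~²y)

  exchange-stable : ∀ {S} → Stable G S → Stable G (exchange S)
  exchange-stable S-stable a b a∈ b∈ ab with ∈-exchange⁻ a∈ | ∈-exchange⁻ b∈
  ... | inj₁ (a∈S , _) | inj₁ (b∈S , _) = S-stable a b a∈S b∈S ab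
  ... | inj₁ a-kept | inj₂ (_ , b-free) = b-free (a , a-kept , E-sym ab)
  ... | inj₂ (_ , a-free) | inj₁ b-kept = a-free (b , b-kept , ab)
  ... | inj₂ (x~²a , _) | inj₂ (x~²b , _) =
    proj₂ bip a b ab (trans (sym (N²-sameColour G bip x~²a)) (N²-sameColour G bip x~²b))

  -- A vertex v outside exchange S is dominated: by x if v ∈ N(x); otherwise
  -- v ∉ S, and a neighbour w ∈ S of v is either kept, or lies in N(x), and
  -- then v ∈ N²(x) was not freed only because it has a kept neighbour.
  exchange-dominating : ∀ {S} → Dominating G S → Dominating G (exchange S)
  exchange-dominating {S} S-dom v v∉ with E? x v
  ... | yes xv = x , x∈exchange S , E-sym xv
  ... | no ¬xv with v ∈? S
  ...   | yes v∈S = ⊥-elim (v∉ (∈-exchange⁺ (inj₁ (v∈S , ¬xv))))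
  ...   | no v∉S with S-dom v v∉S
  ...     | w , w∈S , vw with E? x w
  ...       | no ¬xw = w , ∈-exchange⁺ (inj₁ (w∈S , ¬xw)) , vw
  ...       | yes xw with any? (λ u → kept? S u ×-dec E? v u)
  ...         | yes (u , u-kept , vu) = u , ∈-exchange⁺ (inj₁ u-kept) , vu
  ...         | no ¬kept-neighbour =
                ⊥-elim (v∉ (∈-exchange⁺ (inj₂ ((w , xw , E-sym vw) , ¬kept-neighbour))))

  exchange-maximal : ∀ {S} → MaximalStable G S → MaximalStable G (exchange S)
  exchange-maximal S-max =
    stable∧dominating⇒maximal G (exchange-stable (proj₁ S-max))
      (exchange-dominating (maximal⇒dominating G E? S-max))

  module _ {S} (S-max : MaximalStable G S) (y∈S : y ∈ S) where

    N²x∩S≡∅ : ∀ {z} → InN² G x z → z ∉ S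
    N²x∩S≡∅ {z} x~²z z∈S = proj₁ S-max y z y∈S z∈S (N²x⊆Ny z x~²z)

    Nx⊆S : ∀ {u} → E x u → u ∈ S
    Nx⊆S {u} xu with u ∈? S
    ... | yes u∈S = u∈S
    ... | no u∉S with w , w∈S , uw ← maximal⇒dominating G E? S-max u u∉S =
      ⊥-elim (N²x∩S≡∅ (u , xu , uw) w∈S)

    ∈-recover⁺ : ∀ {v} → v ∈ S → E x v ⊎ (v ∈ exchange S × ¬ InN² G x v)
    ∈-recover⁺ {v} v∈S with E? x v
    ... | yes xv = inj₁ xv
    ... | no ¬xv = inj₂ (∈-exchange⁺ (inj₁ (v∈S , ¬xv)) , λ x~²v → N²x∩S≡∅ x~²v v∈S)

    ∈-recover⁻ : ∀ {v} → E x v ⊎ (v ∈ exchange S × ¬ InN² G x v) → v ∈ S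
    ∈-recover⁻ (inj₁ xv) = Nx⊆S xv
    ∈-recover⁻ (inj₂ (v∈ , ¬x~²v)) with ∈-exchange⁻ v∈
    ... | inj₁ (v∈S , _) = v∈S
    ... | inj₂ (x~²v , _) = ⊥-elim (¬x~²v x~²v)

  exchange-reflects-⊆ : ∀ {S S'} → MaximalStable G S → y ∈ S → MaximalStable G S' → y ∈ S'
    → exchange S ≡ exchange S' → S ⊆ S'
  exchange-reflects-⊆ S-max y∈S S'-max y∈S' eq v∈S with ∈-recover⁺ S-max y∈S v∈S
  ... | inj₁ xv = ∈-recover⁻ S'-max y∈S' (inj₁ xv)
  ... | inj₂ (v∈ , ¬x~²v) = ∈-recover⁻ S'-max y∈S' (inj₂ (subst (_ ∈_) eq v∈ , ¬x~²v))

  rare : Rare G y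
  rare LA LAy _ LA-spec LAy! LAy-spec = double-length≤ exchange LAy! injective ∉LAy LAy⊆LA ∈LA
    where
    inAy : ∀ {S} → S ∈ₗ LAy → MaximalStable G S × y ∈ S
    inAy = Equivalence.to (LAy-spec _)

    inA : ∀ {S} → MaximalStable G S → S ∈ₗ LA
    inA = Equivalence.from (LA-spec _)

    injective : ∀ {S S'} → S ∈ₗ LAy → S' ∈ₗ LAy → exchange S ≡ exchange S' → S ≡ S'
    injective S∈ S'∈ eq with (S-max , y∈S) ← inAy S∈ | (S'-max , y∈S') ← inAy S'∈ =
      ⊆-antisym (exchange-reflects-⊆ S-max y∈S S'-max y∈S' eq)
                (exchange-reflects-⊆ S'-max y∈S' S-max y∈S (sym eq))

    ∉LAy : ∀ {S} → S ∈ₗ LAy → exchange S ∉ₗ LAy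
    ∉LAy {S} _ ex∈ = y∉exchange S (proj₂ (inAy ex∈))

    LAy⊆LA : LAy ⊆ₗ LA
    LAy⊆LA S∈ = inA (proj₁ (inAy S∈))

    ∈LA : ∀ {S} → S ∈ₗ LAy → exchange S ∈ₗ LA
    ∈LA S∈ = inA (exchange-maximal (proj₁ (inAy S∈)))

-- Adjacency need not be decidable, but the conclusion is a decidable
-- inequality, so decidability of E may be assumed under a double negation.
lemma7 : ∀ {n : ℕ} (G : Graph n) → Bipartite G → (x y : Fin n)
       → Graph.E G x y
       → (∀ z → InN² G x z → InN G y z)
       → Rare G y
lemma7 {n} G bip x y xy N²x⊆Ny LA LAy LA! LA-spec LAy! LAy-spec =
  decidable-stable (_ ≤? _) (¬¬-map rare ¬¬E?)
  where
  rare : Decidable (Graph.E G) → 2 * length LAy ≤ length LA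
  rare E? = Exchange.rare G E? bip xy N²x⊆Ny LA LAy LA! LA-spec LAy! LAy-spec

  ¬¬E? : ¬ ¬ Decidable (Graph.E G)
  ¬¬E? = ¬¬-Π-Fin n λ u → ¬¬-Π-Fin n λ v → ¬¬-excluded-middle
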